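{- For every EDML formula $\varphi$ there exists an equivalent DN formula $\varphi'$ with $|\varphi'|=O(|\varphi|)$.
   Context: Graphs are finite, simple, vertex-colored (unary relation symbols $\mathbf P$ interpreted as subsets $\mathbf P(G)\subseteq V(G)$). $N^r(v)=\{u\ne v:\mathrm{dist}_G(u,v)\le r\}$; $N^r_d(U)=\{v:|N^r(v)\cap U|\ge d\}$ for $d,r\in\mathbb N^+$. $|\cdot|$ denotes formula length (number of symbols, each number counting as one). DN logic: existential MSO over graphs (quantification over vertices and vertex sets; atomic $E(x,y)$, $x=y$, $x\in X$, $\mathbf P(x)$; only existential quantifiers; negation only of quantifier-free formulas) extended by size measurements $|t|=m,|t|\le m,|t|\ge m$ and comparisons $t_1=t_2$, $t_1\subseteq t_2$, $t_1\supseteq t_2$ of neighborhood terms, which are built from set variables, unary relation symbols and $\emptyset$ by complement, $\cap$, $\cup$, $\setminus$ and $N^r_d(\cdot)$. EDML: set variables $X$ and unary relation symbols $\mathbf P$ are unfinished inner formulas; for unfinished $\psi$ and $d,r\in\mathbb N^+$, $\square^r_d\psi$ is unfinished and $\rangle\square_d\psi$ is finished; $|X|\le m$, $|X|\ge m$ are finished; negations/conjunctions of unfinished (finished) formulas are unfinished (finished); EDML formulas are finished inner formulas and $\exists X\,\psi$ for $\psi$ finished or an EDML formula. Unfinished formulas are evaluated at an active vertex $v$: $X$ holds iff $v\in\beta(X)$, $\mathbf P$ iff $v\in\mathbf P(G)$, $\square^r_d\psi$ iff at least $d$ vertices $w\in N^r(v)$ satisfy $\psi$ at $w$; $\rangle\square_d\psi$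 holds iff at least $d$ vertices of $G$ satisfy $\psi$; the rest is as usual. Two formulas are equivalent if they have the same truth value for every graph and every assignment of vertex sets to the free set variables. -}

module Defs where

open import Data.Nat using (ℕ; zero; suc; _+_; _*_; _≤_; _≤ᵇ_; NonZero)
open import Data.Nat.Properties using () renaming (_≟_ to _≟ℕ_)
open import Data.Bool using (Bool; true; false; not; _∧_; _∨_; if_then_else_; T)
open import Data.Fin using (Fin; zero; suc)
open import Data.Fin.Properties using () renaming (_≟_ to _≟F_)
open import Data.Fin.Subset using (Subset; ∣_∣; _∩_; _∪_; _─_; ∁; ⊥; _⊆_)
open import Data.Vec using (Vec; []; _∷_; lookup; tabulate)
import Data.List as L
open import Data.Bool.ListAction using (any)
open import Data.Product using (Σ; _×_)
open import Relation.Nullary using (¬_; ⌊_⌋)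
open import Relation.Binary.PropositionalEquality using (_≡_)
open import Function.Bundles using (_⇔_)

-- Finite simple vertex-coloured graphs on vertex set Fin n.
-- Unary relation symbols are indexed by ℕ; colour P is the set P(G).

record Graph (n : ℕ) : Set where
  field
    adj    : Fin n → Fin n → Bool
    sym    : ∀ u v → adj u v ≡ adj v u
    irrefl : ∀ v → adj v v ≡ false
    colour : ℕ → Subset n
open Graph public

within : ∀ {n} → Graph n → ℕ → Fin n → Fin n → Bool
within G zero    u v = ⌊ u ≟F v ⌋
within {n} G (suc r) u v =
  within G r u v ∨ any (λ w → adj G u w ∧ within G r w v) (L.allFin n)

Nbh : ∀ {n} → Graph n → ℕ → Fin n → Subset n
Nbh G r v = tabulate (λ u → not ⌊ u ≟F v ⌋ ∧ within G r v u)

Nrd : ∀ {n} → Graph n → ℕ → ℕ → Subset n → Subset n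
Nrd G r d U = tabulate (λ v → d ≤ᵇ ∣ Nbh G r v ∩ U ∣)

SetAsg : ℕ → Set
SetAsg n = ℕ → Subset n

update : ∀ {n} → SetAsg n → ℕ → Subset n → SetAsg n
update β X S Y = if ⌊ Y ≟ℕ X ⌋ then S else β Y

data Unf : Set where
  var  : ℕ → Unf
  rel  : ℕ → Unf
  box  : (r d : ℕ) → {{NonZero r}} → {{NonZero d}} → Unf → Unf
  neg  : Unf → Unf
  conj : Unf → Unf → Unf

data Fin' : Set where
  gbox  : (d : ℕ) → {{NonZero d}} → Unf → Fin'
  card≤ : ℕ → ℕ → Fin'
  card≥ : ℕ → ℕ → Fin'
  neg   : Fin' → Fin'
  conj  : Fin' → Fin' → Fin'

data EDML : Set where
  fin : Fin' → EDML
  ex  : ℕ → EDML → EDML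

evalUnf : ∀ {n} → Graph n → SetAsg n → Unf → Fin n → Bool
evalUnf G β (var X) v = lookup (β X) v
evalUnf G β (rel P) v = lookup (colour G P) v
evalUnf G β (box r d ψ) v = d ≤ᵇ ∣ Nbh G r v ∩ tabulate (evalUnf G β ψ) ∣
evalUnf G β (neg ψ) v = not (evalUnf G β ψ v)
evalUnf G β (conj ψ χ) v = evalUnf G β ψ v ∧ evalUnf G β χ v

evalFin : ∀ {n} → Graph n → SetAsg n → Fin' → Set
evalFin G β (gbox d ψ) = d ≤ ∣ tabulate (evalUnf G β ψ) ∣
evalFin G β (card≤ X m) = ∣ β X ∣ ≤ m
evalFin G β (card≥ X m) = m ≤ ∣ β X ∣
evalFin G β (neg ψ) = ¬ evalFin G β ψ
evalFin G β (conj ψ χ) = evalFin G β ψ × evalFin G β χ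

evalEDML : ∀ {n} → Graph n → SetAsg n → EDML → Set
evalEDML G β (fin ψ) = evalFin G β ψ
evalEDML {n} G β (ex X φ) = Σ (Subset n) (λ S → evalEDML G (update β X S) φ)

-- length: every constructor symbol counts one, every number counts one
lenUnf : Unf → ℕ
lenUnf (var X) = 1
lenUnf (rel P) = 1
lenUnf (box r d ψ) = 3 + lenUnf ψ
lenUnf (neg ψ) = 1 + lenUnf ψ
lenUnf (conj ψ χ) = 1 + lenUnf ψ + lenUnf χ

lenFin : Fin' → ℕ
lenFin (gbox d ψ) = 3 + lenUnf ψ
lenFin (card≤ X m) = 5
lenFin (card≥ X m) = 5
lenFin (neg ψ) = 1 + lenFin ψ
lenFin (conj ψ χ) = 1 + lenFin ψ + lenFin χ

lenEDML : EDML → ℕ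
lenEDML (fin ψ) = lenFin ψ
lenEDML (ex X φ) = 2 + lenEDML φ

data Term : Set where
  var  : ℕ → Term
  rel  : ℕ → Term
  empty : Term
  compl : Term → Term
  _∩ₜ_ : Term → Term → Term
  _∪ₜ_ : Term → Term → Term
  _∖ₜ_ : Term → Term → Term
  nbh  : (r d : ℕ) → {{NonZero r}} → {{NonZero d}} → Term → Term

-- quantifier-free DN formulas with k vertex variables in scope (de Bruijn, Fin k)
data QF (k : ℕ) : Set where
  edge   : Fin k → Fin k → QF k
  eq     : Fin k → Fin k → QF k
  mem    : Fin k → ℕ → QF k
  rel    : ℕ → Fin k → QF k
  size=  : Term → ℕ → QF k
  size≤  : Term → ℕ → QF k
  size≥  : Term → ℕ → QF k
  teq    : Term → Term → QF k
  tsub   : Term → Term → QF k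
  tsup   : Term → Term → QF k
  neg    : QF k → QF k
  conj   : QF k → QF k → QF k
  disj   : QF k → QF k → QF k

data DN (k : ℕ) : Set where
  qf    : QF k → DN k
  conj  : DN k → DN k → DN k
  disj  : DN k → DN k → DN k
  exV   : DN (suc k) → DN k                         -- ∃x (new variable = index zero)
  exS   : ℕ → DN k → DN k

evalTerm : ∀ {n} → Graph n → SetAsg n → Term → Subset n
evalTerm G β (var X) = β X
evalTerm G β (rel P) = colour G P
evalTerm G β empty = ⊥
evalTerm G β (compl t) = ∁ (evalTerm G β t)
evalTerm G β (t ∩ₜ s) = evalTerm G β t ∩ evalTerm G β s
evalTerm G β (t ∪ₜ s) = evalTerm G β t ∪ evalTerm G β s
evalTerm G β (t ∖ₜ s) = evalTerm G β t ─ evalTerm G β s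
evalTerm G β (nbh r d t) = Nrd G r d (evalTerm G β t)

evalQF : ∀ {n k} → Graph n → Vec (Fin n) k → SetAsg n → QF k → Set
evalQF G α β (edge x y) = T (adj G (lookup α x) (lookup α y))
evalQF G α β (eq x y) = lookup α x ≡ lookup α y
evalQF G α β (mem x X) = T (lookup (β X) (lookup α x))
evalQF G α β (rel P x) = T (lookup (colour G P) (lookup α x))
evalQF G α β (size= t m) = ∣ evalTerm G β t ∣ ≡ m
evalQF G α β (size≤ t m) = ∣ evalTerm G β t ∣ ≤ m
evalQF G α β (size≥ t m) = m ≤ ∣ evalTerm G β t ∣
evalQF G α β (teq t s) = evalTerm G β t ≡ evalTerm G β s
evalQF G α β (tsub t s) = evalTerm G β t ⊆ evalTerm G β s
evalQF G α β (tsup t s) = evalTerm G β s ⊆ evalTerm G β t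
evalQF G α β (neg ψ) = ¬ evalQF G α β ψ
evalQF G α β (conj ψ χ) = evalQF G α β ψ × evalQF G α β χ
evalQF G α β (disj ψ χ) = evalQF G α β ψ Data.Sum.⊎ evalQF G α β χ
  where import Data.Sum

evalDN : ∀ {n k} → Graph n → Vec (Fin n) k → SetAsg n → DN k → Set
evalDN G α β (qf ψ) = evalQF G α β ψ
evalDN G α β (conj φ ψ) = evalDN G α β φ × evalDN G α β ψ
evalDN G α β (disj φ ψ) = evalDN G α β φ Data.Sum.⊎ evalDN G α β ψ
  where import Data.Sum
evalDN {n} G α β (exV φ) = Σ (Fin n) (λ v → evalDN G (v ∷ α) β φ)
evalDN {n} G α β (exS X φ) = Σ (Subset n) (λ S → evalDN G α (update β X S) φ)

lenTerm : Term → ℕ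
lenTerm (var X) = 1
lenTerm (rel P) = 1
lenTerm empty = 1
lenTerm (compl t) = 1 + lenTerm t
lenTerm (t ∩ₜ s) = 1 + lenTerm t + lenTerm s
lenTerm (t ∪ₜ s) = 1 + lenTerm t + lenTerm s
lenTerm (t ∖ₜ s) = 1 + lenTerm t + lenTerm s
lenTerm (nbh r d t) = 3 + lenTerm t

lenQF : ∀ {k} → QF k → ℕ
lenQF (edge x y) = 3
lenQF (eq x y) = 3
lenQF (mem x X) = 3
lenQF (rel P x) = 2
lenQF (size= t m) = 4 + lenTerm t
lenQF (size≤ t m) = 4 + lenTerm t
lenQF (size≥ t m) = 4 + lenTerm t
lenQF (teq t s) = 1 + lenTerm t + lenTerm s
lenQF (tsub t s) = 1 + lenTerm t + lenTerm s
lenQF (tsup t s) = 1 + lenTerm t + lenTerm s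
lenQF (neg ψ) = 1 + lenQF ψ
lenQF (conj ψ χ) = 1 + lenQF ψ + lenQF χ
lenQF (disj ψ χ) = 1 + lenQF ψ + lenQF χ

lenDN : ∀ {k} → DN k → ℕ
lenDN (qf ψ) = lenQF ψ
lenDN (conj φ ψ) = 1 + lenDN φ + lenDN ψ
lenDN (disj φ ψ) = 1 + lenDN φ + lenDN ψ
lenDN (exV φ) = 2 + lenDN φ
lenDN (exS X φ) = 2 + lenDN φ

Equivalent : EDML → DN 0 → Set
Equivalent φ φ' = ∀ (n : ℕ) (G : Graph n) (β : SetAsg n) →
  evalEDML G β φ ⇔ evalDN G [] β φ'

{-# OPTIONS --safe #-}
module Submission where

-- An unfinished EDML formula ψ defines, at every active vertex, the membership of that
-- vertex in a set, and this set is denoted by a neighbourhood term t_ψ: □^r_d becomes N^r_d,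
-- negation complement and conjunction intersection.  A finished formula ⟩□_d ψ then says
-- |t_ψ| ≥ d, and |X| ≤ m, |X| ≥ m are size measurements of the term X.  Existential set
-- quantifiers translate verbatim, and every symbol is replaced by at most two.

open import Defs hiding (sym)
open import Data.Nat using (ℕ; zero; suc; _+_; _*_; _≤_)
open import Data.Nat.Properties using (≤-trans; ≤-reflexive; ≤ᵇ⇒≤; +-mono-≤; *-distribˡ-+; m≤n*m)
open import Data.Product using (Σ; _×_; _,_)
open import Data.Product.Function.NonDependent.Propositional using (_×-⇔_)
open import Data.Product.Function.Dependent.Propositional using (Σ-⇔)
open import Data.Bool using (not; _∧_)
open import Data.Fin using (Fin; zero; suc)
open import Data.Vec using ([]; _∷_; tabulate; zipWith)
open import Data.Vec.Properties using (tabulate∘lookup; tabulate-∘)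
open import Data.Fin.Subset using (_∩_; ∁)
open import Relation.Binary.PropositionalEquality using (_≡_; refl; sym; trans; cong; cong₂)
open import Function using (_∘_)
open import Function.Bundles using (_⇔_)
open import Function.Construct.Identity using (⇔-id; ↠-id)
open import Function.Related.TypeIsomorphisms using (¬-cong-⇔)

zipWith-tabulate : ∀ {a b c} {A : Set a} {B : Set b} {C : Set c} {n}
                   (_∙_ : A → B → C) (f : Fin n → A) (g : Fin n → B) →
                   zipWith _∙_ (tabulate f) (tabulate g) ≡ tabulate (λ v → f v ∙ g v)
zipWith-tabulate {n = zero}  _∙_ f g = refl
zipWith-tabulate {n = suc n} _∙_ f g =
  cong (f zero ∙ g zero ∷_) (zipWith-tabulate _∙_ (f ∘ suc) (g ∘ suc))

+-mono-≤-double : ∀ {k a} l b → k ≤ 2 * l → a ≤ 2 * b → k + a ≤ 2 * (l + b)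
+-mono-≤-double l b k≤2l a≤2b =
  ≤-trans (+-mono-≤ k≤2l a≤2b) (≤-reflexive (sym (*-distribˡ-+ 2 l b)))

unfTerm : Unf → Term
unfTerm (var X)     = var X
unfTerm (rel P)     = rel P
unfTerm (box r d ψ) = nbh r d (unfTerm ψ)
unfTerm (neg ψ)     = compl (unfTerm ψ)
unfTerm (conj ψ χ)  = unfTerm ψ ∩ₜ unfTerm χ

evalTerm-unfTerm : ∀ {n} (G : Graph n) (β : SetAsg n) (ψ : Unf) →
                   evalTerm G β (unfTerm ψ) ≡ tabulate (evalUnf G β ψ)
evalTerm-unfTerm G β (var X)     = sym (tabulate∘lookup (β X))
evalTerm-unfTerm G β (rel P)     = sym (tabulate∘lookup (colour G P))
evalTerm-unfTerm G β (box r d ψ) = cong (Nrd G r d) (evalTerm-unfTerm G β ψ)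
evalTerm-unfTerm G β (neg ψ)     =
  trans (cong ∁ (evalTerm-unfTerm G β ψ)) (sym (tabulate-∘ not (evalUnf G β ψ)))
evalTerm-unfTerm G β (conj ψ χ)  =
  trans (cong₂ _∩_ (evalTerm-unfTerm G β ψ) (evalTerm-unfTerm G β χ))
        (zipWith-tabulate _∧_ (evalUnf G β ψ) (evalUnf G β χ))

lenTerm-unfTerm : ∀ ψ → lenTerm (unfTerm ψ) ≡ lenUnf ψ
lenTerm-unfTerm (var X)     = refl
lenTerm-unfTerm (rel P)     = refl
lenTerm-unfTerm (box r d ψ) = cong (3 +_) (lenTerm-unfTerm ψ)
lenTerm-unfTerm (neg ψ)     = cong suc (lenTerm-unfTerm ψ)
lenTerm-unfTerm (conj ψ χ)  = cong₂ (λ a b → suc (a + b)) (lenTerm-unfTerm ψ) (lenTerm-unfTerm χ)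

finQF : Fin' → QF 0
finQF (gbox d ψ)  = size≥ (unfTerm ψ) d
finQF (card≤ X m) = size≤ (var X) m
finQF (card≥ X m) = size≥ (var X) m
finQF (neg ψ)     = neg (finQF ψ)
finQF (conj ψ χ)  = conj (finQF ψ) (finQF χ)

evalQF-finQF : ∀ {n} (G : Graph n) (β : SetAsg n) (ψ : Fin') →
               evalFin G β ψ ⇔ evalQF G [] β (finQF ψ)
evalQF-finQF G β (gbox d ψ) rewrite evalTerm-unfTerm G β ψ = ⇔-id _
evalQF-finQF G β (card≤ X m) = ⇔-id _
evalQF-finQF G β (card≥ X m) = ⇔-id _
evalQF-finQF G β (neg ψ)     = ¬-cong-⇔ (evalQF-finQF G β ψ)
evalQF-finQF G β (conj ψ χ)  = evalQF-finQF G β ψ ×-⇔ evalQF-finQF G β χ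

lenQF-finQF : ∀ ψ → lenQF (finQF ψ) ≤ 2 * lenFin ψ
lenQF-finQF (gbox d ψ) rewrite lenTerm-unfTerm ψ =
  +-mono-≤-double 3 (lenUnf ψ) (≤ᵇ⇒≤ 4 6 _) (m≤n*m (lenUnf ψ) 2)
lenQF-finQF (card≤ X m) = m≤n*m 5 2
lenQF-finQF (card≥ X m) = m≤n*m 5 2
lenQF-finQF (neg ψ)     = +-mono-≤-double 1 (lenFin ψ) (m≤n*m 1 2) (lenQF-finQF ψ)
lenQF-finQF (conj ψ χ)  =
  +-mono-≤-double (1 + lenFin ψ) (lenFin χ)
    (+-mono-≤-double 1 (lenFin ψ) (m≤n*m 1 2) (lenQF-finQF ψ)) (lenQF-finQF χ)

edmlDN : EDML → DN 0
edmlDN (fin ψ)  = qf (finQF ψ)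
edmlDN (ex X φ) = exS X (edmlDN φ)

evalDN-edmlDN : ∀ {n} (G : Graph n) (β : SetAsg n) (φ : EDML) →
                evalEDML G β φ ⇔ evalDN G [] β (edmlDN φ)
evalDN-edmlDN G β (fin ψ)  = evalQF-finQF G β ψ
evalDN-edmlDN G β (ex X φ) = Σ-⇔ (↠-id _) (λ {S} → evalDN-edmlDN G (update β X S) φ)

lenDN-edmlDN : ∀ φ → lenDN (edmlDN φ) ≤ 2 * lenEDML φ
lenDN-edmlDN (fin ψ)  = lenQF-finQF ψ
lenDN-edmlDN (ex X φ) = +-mono-≤-double 2 (lenEDML φ) (m≤n*m 2 2) (lenDN-edmlDN φ)

lemma7p2 : Σ ℕ (λ c → (φ : EDML) →
             Σ (DN 0) (λ φ' → Equivalent φ φ' × lenDN φ' ≤ c * lenEDML φ))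
lemma7p2 = 2 , λ φ → edmlDN φ , (λ n G β → evalDN-edmlDN G β φ) , lenDN-edmlDN φ
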